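{- Let $n$ be a positive integer. (i) If $n$ is even, then $s(\mathbb{Z}_n,3)=\lfloor n/4\rfloor$. (ii) If $n$ is odd and has no prime divisor congruent to $5 \pmod 6$, then $s(\mathbb{Z}_n,3)\ge\lfloor n/6\rfloor$. (iii) If $n$ is odd and $p$ is its smallest prime divisor congruent to $5\pmod 6$, then $s(\mathbb{Z}_n,3)\ge \frac{p+1}{6p}\,n$.
   Context: For an abelian group $G$ (written additively) and a positive integer $t$, a subset $S\subseteq G$ is $t$-free if for all non-negative integers $k,l$ with $k+l\le t$, a sum of $k$ (not necessarily distinct) elements of $S$ equals a sum of $l$ (not necessarily distinct) elements of $S$ only if $k=l$ and the two sums consist of the same terms (as multisets). $s(G,t)$ denotes the maximum cardinality of a $t$-free set in $G$; $\mathbb{Z}_n$ is the cyclic group of order $n$. -}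

module Defs where

open import Data.Nat using (ℕ; zero; suc; _+_; _*_; _≤_; NonZero)
open import Data.Nat.DivMod using (_%_)
open import Data.Fin using (Fin; toℕ)
import Data.Fin as F
open import Data.Fin.Subset using (Subset; _∈_; ∣_∣)
open import Data.Product using (∃; _×_; _,_)
open import Relation.Binary.PropositionalEquality using (_≡_)
open import Relation.Nullary using (¬_)

Σ : (n : ℕ) → (Fin n → ℕ) → ℕ
Σ zero    f = 0
Σ (suc n) f = f F.zero + Σ n (λ i → f (F.suc i))

-- The group ℤ_n is modelled with carrier Fin n (representatives 0..n-1);
-- a subset S ⊆ ℤ_n is a Subset n.
-- A finite multiset of elements of ℤ_n is a multiplicity function Fin n → ℕ;
-- it consists of elements of S if every element outside S has multiplicity 0.
MultisetOver : {n : ℕ} → Subset n → (Fin n → ℕ) → Set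
MultisetOver S c = ∀ i → ¬ (i ∈ S) → c i ≡ 0

size : {n : ℕ} → (Fin n → ℕ) → ℕ
size {n} c = Σ n c

-- the sum in ℤ_n of the terms of the multiset, as a natural number
-- (to be compared modulo n)
msum : {n : ℕ} → (Fin n → ℕ) → ℕ
msum {n} c = Σ n (λ i → c i * toℕ i)

TFree : (n : ℕ) .{{_ : NonZero n}} → ℕ → Subset n → Set
TFree n t S =
  ∀ (c d : Fin n → ℕ) → MultisetOver S c → MultisetOver S d →
  size c + size d ≤ t →
  msum c % n ≡ msum d % n →
  ∀ i → c i ≡ d i

SIs : (n : ℕ) .{{_ : NonZero n}} → ℕ → ℕ → Set
SIs n t m =
  (∃ λ (S : Subset n) → TFree n t S × ∣ S ∣ ≡ m) ×
  (∀ (S : Subset n) → TFree n t S → ∣ S ∣ ≤ m)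

SAtLeast : (n : ℕ) .{{_ : NonZero n}} → ℕ → ℕ → Set
SAtLeast n t b = ∃ λ (S : Subset n) → TFree n t S × b ≤ ∣ S ∣

-- a / b ≤ s(ℤ_n, t)  (for b > 0): some t-free set S has a ≤ b * |S|.
SAtLeastFrac : (n : ℕ) .{{_ : NonZero n}} → ℕ → ℕ → ℕ → Set
SAtLeastFrac n t a b = ∃ λ (S : Subset n) → TFree n t S × a ≤ b * ∣ S ∣

module Submission where

-- If S is 3-free and a ∈ S, the four sets S, -S, a + S and a - S
-- are pairwise disjoint and each is in bijection with S: every coincidence
-- would be a relation x + y = 0, x + y = z or x + y + z = 0 inside S.  Hence
-- 4 |S| ≤ n for every n (only part (i) needs it).
--
-- Lower bounds come from two explicit constructions.
--  * n even: the odd x with 2x < n.  Reducing a relation mod 2 shows the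
--    numbers of terms k, l have equal parity, so the only possible relation
--    with k ≠ l, k + l ≤ 3 is x + y = 0, impossible since 0 < x + y < n.
--  * q ∣ n: the x whose residue r = x mod q lies in the window q < 3r, 2r < q.
--    A sum R of k ≤ 3 window residues satisfies kq < 3R and 2R < kq, so no
--    such sum is ≡ 0 mod q, and a one-term sum (in (q/3, q/2)) never meets a
--    two-term sum (in (2q/3, q)); these are all the relations with k + l ≤ 3.
--    A run of c consecutive window residues lifts to c · (n / q) elements;
--    with q = n this gives ⌊n/6⌋ (n odd), with q = p it gives (p+1)/6 · n/p.

open import Defs
open import Data.Bool using (true; false; if_then_else_)
open import Data.Empty using (⊥; ⊥-elim)
open import Data.Fin using (Fin; toℕ; fromℕ<; remQuot; combine) renaming (zero to fz; suc to fs)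
open import Data.Fin.Properties
  using (_≟_; toℕ<n; toℕ-injective; toℕ-fromℕ<; injective⇒≤; combine-remQuot)
  renaming (suc-injective to fs-injective)
open import Data.Fin.Subset using (Subset; _∈_; ∣_∣)
open import Data.Fin.Subset.Properties using (_∈?_)
open import Data.List using (List; []; _∷_; length; map)
open import Data.Nat.ListAction using (sum)
open import Data.List.Relation.Unary.All using (All; []; _∷_)
open import Data.Nat using (ℕ; zero; suc; _+_; _*_; _∸_; _≤_; _<_; _<?_; z≤n; s≤s; NonZero; >-nonZero⁻¹)
open import Data.Nat.DivMod
open import Data.Nat.Divisibility using (_∣_; ∣-refl; m%n≡0⇒n∣m)
open import Data.Nat.Primality using (Prime)
open import Data.Nat.Properties renaming (_≟_ to _≟ℕ_)
open import Data.Nat.Tactic.RingSolver using (solve-∀)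
open import Data.Product using (∃; Σ-syntax; _×_; _,_; proj₁; proj₂; uncurry)
open import Data.Vec using ([]; _∷_; here; there; tabulate)
open import Data.Vec.Properties using (lookup∘tabulate; []=⇒lookup; lookup⇒[]=)
open import Function using (_∘_)
open import Function.Definitions using (Injective)
open import Relation.Binary.PropositionalEquality
open import Relation.Nullary using (¬_; yes; no; does; Dec)
open import Relation.Nullary.Decidable using (_×-dec_)
open import Relation.Unary using (Decidable)

Σ-cong : ∀ n {f g : Fin n → ℕ} → (∀ i → f i ≡ g i) → Σ n f ≡ Σ n g
Σ-cong zero    eq = refl
Σ-cong (suc n) eq = cong₂ _+_ (eq fz) (Σ-cong n (eq ∘ fs))

Σ-mono : ∀ n {f g : Fin n → ℕ} → (∀ i → f i ≤ g i) → Σ n f ≤ Σ n g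
Σ-mono zero    le = z≤n
Σ-mono (suc n) le = +-mono-≤ (le fz) (Σ-mono n (le ∘ fs))

Σ-+ : ∀ n (f g : Fin n → ℕ) → Σ n (λ i → f i + g i) ≡ Σ n f + Σ n g
Σ-+ zero    f g = refl
Σ-+ (suc n) f g = trans (cong (f fz + g fz +_) (Σ-+ n (f ∘ fs) (g ∘ fs)))
                        (+-+-interchange (f fz) (g fz) _ _)
  where
  +-+-interchange : ∀ a b c d → a + b + (c + d) ≡ a + c + (b + d)
  +-+-interchange = solve-∀

Σ-*ˡ : ∀ n (f : Fin n → ℕ) k → Σ n (λ i → k * f i) ≡ k * Σ n f
Σ-*ˡ zero    f k = sym (*-zeroʳ k)
Σ-*ˡ (suc n) f k = trans (cong (k * f fz +_) (Σ-*ˡ n (f ∘ fs) k))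
                         (sym (*-distribˡ-+ k (f fz) _))

Σ-*ʳ : ∀ n (f : Fin n → ℕ) k → Σ n (λ i → f i * k) ≡ Σ n f * k
Σ-*ʳ zero    f k = refl
Σ-*ʳ (suc n) f k = trans (cong (f fz * k +_) (Σ-*ʳ n (f ∘ fs) k))
                         (sym (*-distribʳ-+ k (f fz) _))

Σ-zero : ∀ n → Σ n (λ _ → 0) ≡ 0
Σ-zero zero    = refl
Σ-zero (suc n) = Σ-zero n

Σ≡0 : ∀ n {f : Fin n → ℕ} → Σ n f ≡ 0 → ∀ i → f i ≡ 0
Σ≡0 (suc n) {f} eq fz     = m+n≡0⇒m≡0 (f fz) eq
Σ≡0 (suc n) {f} eq (fs i) = Σ≡0 n (m+n≡0⇒n≡0 (f fz) eq) i

Σ-mod : ∀ n q .{{_ : NonZero q}} {f g : Fin n → ℕ} →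
        (∀ i → f i % q ≡ g i % q) → Σ n f % q ≡ Σ n g % q
Σ-mod zero    q h = refl
Σ-mod (suc n) q {f} {g} h = begin
  (f fz + Σ n (f ∘ fs)) % q               ≡⟨ %-distribˡ-+ (f fz) _ q ⟩
  (f fz % q + Σ n (f ∘ fs) % q) % q       ≡⟨ cong₂ (λ a b → (a + b) % q) (h fz) (Σ-mod n q (h ∘ fs)) ⟩
  (g fz % q + Σ n (g ∘ fs) % q) % q       ≡⟨ %-distribˡ-+ (g fz) _ q ⟨
  (g fz + Σ n (g ∘ fs)) % q               ∎
  where open ≡-Reasoning

δ : ∀ {n} → Fin n → Fin n → ℕ
δ a i = if does (i ≟ a) then 1 else 0

Σ-δ : ∀ n (a : Fin n) (g : Fin n → ℕ) → Σ n (λ i → δ a i * g i) ≡ g a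
Σ-δ (suc n) fz     g = trans (cong₂ _+_ (+-identityʳ (g fz)) (Σ-zero n)) (+-identityʳ (g fz))
Σ-δ (suc n) (fs a) g = Σ-δ n a (g ∘ fs)

single : ∀ n (c : Fin n → ℕ) → Σ n c ≡ 1 → ∃ λ a → ∀ i → c i ≡ δ a i
single (suc n) c eq with c fz in c₀
... | zero          = let (a , c≡δa) = single n (c ∘ fs) eq in
                      fs a , λ { fz → c₀ ; (fs i) → c≡δa i }
... | suc zero      = fz , λ { fz → c₀ ; (fs i) → Σ≡0 n (suc-injective eq) i }
... | suc (suc _) with () ← eq

module Multisets {n : ℕ} .{{_ : NonZero n}} where

  size-δ : ∀ a → size (δ a) ≡ 1
  size-δ a = trans (Σ-cong n (λ i → sym (*-identityʳ (δ a i)))) (Σ-δ n a (λ _ → 1))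

  msum-δ : ∀ a → msum (δ a) ≡ toℕ a
  msum-δ a = Σ-δ n a toℕ

  bag : List (Fin n) → Fin n → ℕ
  bag []       i = 0
  bag (a ∷ as) i = δ a i + bag as i

  size-bag : ∀ as → size (bag as) ≡ length as
  size-bag []       = Σ-zero n
  size-bag (a ∷ as) = trans (Σ-+ n (δ a) (bag as)) (cong₂ _+_ (size-δ a) (size-bag as))

  msum-bag : ∀ as → msum (bag as) ≡ sum (map toℕ as)
  msum-bag []       = Σ-zero n
  msum-bag (a ∷ as) = begin
    Σ n (λ i → (δ a i + bag as i) * toℕ i)           ≡⟨ Σ-cong n (λ i → *-distribʳ-+ (toℕ i) (δ a i) _) ⟩
    Σ n (λ i → δ a i * toℕ i + bag as i * toℕ i)     ≡⟨ Σ-+ n _ _ ⟩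
    msum (δ a) + msum (bag as)                       ≡⟨ cong₂ _+_ (msum-δ a) (msum-bag as) ⟩
    toℕ a + sum (map toℕ as)                         ∎
    where open ≡-Reasoning

  bag-over : ∀ {S : Subset n} {as} → All (_∈ S) as → MultisetOver S (bag as)
  bag-over []                 i i∉S = refl
  bag-over (_∷_ {a} a∈S as∈S) i i∉S with i ≟ a
  ... | yes refl = ⊥-elim (i∉S a∈S)
  ... | no _     = bag-over as∈S i i∉S

  same-single : ∀ {c d : Fin n → ℕ} → size c ≡ 1 → size d ≡ 1 →
                msum c % n ≡ msum d % n → ∀ i → c i ≡ d i
  same-single {c} {d} sc sd c≡d i with single n c sc | single n d sd
  ... | a , c≡δa | b , d≡δb = trans (c≡δa i) (trans (cong (λ x → δ x i) a≡b) (sym (d≡δb i)))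
    where
    msum-point : ∀ {e} x → (∀ j → e j ≡ δ x j) → msum e ≡ toℕ x
    msum-point x e≡δx = trans (Σ-cong n (λ j → cong (_* toℕ j) (e≡δx j))) (msum-δ x)
    a≡b : a ≡ b
    a≡b = toℕ-injective (begin
      toℕ a          ≡⟨ m<n⇒m%n≡m (toℕ<n a) ⟨
      toℕ a % n      ≡⟨ subst₂ (λ x y → x % n ≡ y % n) (msum-point a c≡δa) (msum-point b d≡δb) c≡d ⟩
      toℕ b % n      ≡⟨ m<n⇒m%n≡m (toℕ<n b) ⟩
      toℕ b          ∎)
      where open ≡-Reasoning

  same-empty : ∀ {c d : Fin n → ℕ} → size c ≡ 0 → size d ≡ 0 → ∀ i → c i ≡ d i
  same-empty sc sd i = trans (Σ≡0 n sc i) (sym (Σ≡0 n sd i))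

  msum-empty : ∀ {c : Fin n → ℕ} → size c ≡ 0 → msum c ≡ 0
  msum-empty {c} sc = trans (Σ-cong n (λ i → cong (_* toℕ i) (Σ≡0 n sc i))) (Σ-zero n)

module Forbidden {n : ℕ} .{{_ : NonZero n}} {S : Subset n} (free : TFree n 3 S) where
  open Multisets {n}

  balanced : ∀ as bs → All (_∈ S) as → All (_∈ S) bs → length as + length bs ≤ 3 →
             sum (map toℕ as) % n ≡ sum (map toℕ bs) % n → length as ≡ length bs
  balanced as bs as∈S bs∈S le eq = begin
    length as          ≡⟨ size-bag as ⟨
    size (bag as)      ≡⟨ Σ-cong n (free (bag as) (bag bs) (bag-over as∈S) (bag-over bs∈S)
                                          (subst₂ (λ k l → k + l ≤ 3) (sym (size-bag as)) (sym (size-bag bs)) le)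
                                          (subst₂ (λ x y → x % n ≡ y % n) (sym (msum-bag as)) (sym (msum-bag bs)) eq)) ⟩
    size (bag bs)      ≡⟨ size-bag bs ⟩
    length bs          ∎
    where open ≡-Reasoning

  private
    +0 : ∀ x → x ≡ x + 0
    +0 x = sym (+-identityʳ x)

  no-x+y≈0 : ∀ {x y} → x ∈ S → y ∈ S → (toℕ x + toℕ y) % n ≡ 0 % n → ⊥
  no-x+y≈0 {x} {y} x∈S y∈S eq with balanced (x ∷ y ∷ []) [] (x∈S ∷ y∈S ∷ []) []
    (s≤s (s≤s z≤n)) (subst (λ s → s % n ≡ 0 % n) (cong (toℕ x +_) (+0 (toℕ y))) eq)
  ... | ()

  no-x+y≈z : ∀ {x y z} → x ∈ S → y ∈ S → z ∈ S → (toℕ x + toℕ y) % n ≡ toℕ z % n → ⊥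
  no-x+y≈z {x} {y} {z} x∈S y∈S z∈S eq with balanced (x ∷ y ∷ []) (z ∷ []) (x∈S ∷ y∈S ∷ []) (z∈S ∷ [])
    (s≤s (s≤s (s≤s z≤n))) (subst₂ (λ s t → s % n ≡ t % n) (cong (toℕ x +_) (+0 (toℕ y))) (+0 (toℕ z)) eq)
  ... | ()

  no-x+y+z≈0 : ∀ {x y z} → x ∈ S → y ∈ S → z ∈ S → (toℕ x + toℕ y + toℕ z) % n ≡ 0 % n → ⊥
  no-x+y+z≈0 {x} {y} {z} x∈S y∈S z∈S eq with balanced (x ∷ y ∷ z ∷ []) [] (x∈S ∷ y∈S ∷ z∈S ∷ []) []
    (s≤s (s≤s (s≤s z≤n)))
    (subst (λ s → s % n ≡ 0 % n) (trans (+-assoc (toℕ x) (toℕ y) (toℕ z))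
                                        (cong (λ t → toℕ x + (toℕ y + t)) (+0 (toℕ z)))) eq)
  ... | ()

-- Congruence modulo n on representatives; n ∸ b represents -b.
module Congruence {n : ℕ} .{{_ : NonZero n}} where
  infix 4 _≈_
  _≈_ : ℕ → ℕ → Set
  x ≈ y = x % n ≡ y % n

  reduce : ℕ → Fin n
  reduce x = fromℕ< (m%n<n x n)

  reduce-injective : ∀ {x y} → reduce x ≡ reduce y → x ≈ y
  reduce-injective {x} {y} eq =
    trans (sym (toℕ-fromℕ< (m%n<n x n))) (trans (cong toℕ eq) (toℕ-fromℕ< (m%n<n y n)))

  ≈⇒≡ : ∀ {a b : Fin n} → toℕ a ≈ toℕ b → a ≡ b
  ≈⇒≡ {a} {b} eq = toℕ-injective (trans (sym (m<n⇒m%n≡m (toℕ<n a))) (trans eq (m<n⇒m%n≡m (toℕ<n b))))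

  +-congʳ : ∀ {x y} z → x ≈ y → x + z ≈ y + z
  +-congʳ {x} {y} z eq = begin
    (x + z) % n                ≡⟨ %-distribˡ-+ x z n ⟩
    (x % n + z % n) % n        ≡⟨ cong (λ t → (t + z % n) % n) eq ⟩
    (y % n + z % n) % n        ≡⟨ %-distribˡ-+ y z n ⟨
    (y + z) % n                ∎
    where open ≡-Reasoning

  +-congˡ : ∀ {x y} z → x ≈ y → z + x ≈ z + y
  +-congˡ {x} {y} z eq = subst₂ _≈_ (+-comm x z) (+-comm y z) (+-congʳ z eq)

  -- Adding w = n ∸ (z mod n) undoes adding z, since z + w is a multiple of n.
  +-cancelˡ : ∀ z {x y} → z + x ≈ z + y → x ≈ y
  +-cancelˡ z {x} {y} eq = trans (sym (undo x)) (trans (+-congˡ w eq) (undo y))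
    where
    w = n ∸ z % n
    z+w : z + w ≡ suc (z / n) * n
    z+w = begin
      z + w                          ≡⟨ cong (_+ w) (m≡m%n+[m/n]*n z n) ⟩
      z % n + z / n * n + w          ≡⟨ +-+-swap (z % n) (z / n * n) w ⟩
      (z % n + w) + z / n * n        ≡⟨ cong (_+ z / n * n) (m+[n∸m]≡n (<⇒≤ (m%n<n z n))) ⟩
      n + z / n * n                  ∎
      where
      open ≡-Reasoning
      +-+-swap : ∀ a b c → a + b + c ≡ a + c + b
      +-+-swap = solve-∀
    undo : ∀ x → w + (z + x) ≈ x
    undo x = begin
      (w + (z + x)) % n              ≡⟨ cong (_% n) (+-assoc w z x) ⟨
      (w + z + x) % n                ≡⟨ cong (λ t → (t + x) % n) (trans (+-comm w z) z+w) ⟩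
      (suc (z / n) * n + x) % n      ≡⟨ cong (_% n) (+-comm (suc (z / n) * n) x) ⟩
      (x + suc (z / n) * n) % n      ≡⟨ [m+kn]%n≡m%n x (suc (z / n)) n ⟩
      x % n                          ∎
      where open ≡-Reasoning

  move-right : ∀ {b x y} → b ≤ n → x ≈ y + (n ∸ b) → x + b ≈ y
  move-right {b} {x} {y} b≤n eq = begin
    (x + b) % n                    ≡⟨ +-congʳ b eq ⟩
    (y + (n ∸ b) + b) % n          ≡⟨ cong (_% n) (+-assoc y (n ∸ b) b) ⟩
    (y + ((n ∸ b) + b)) % n        ≡⟨ cong (λ t → (y + t) % n) (m∸n+n≡m b≤n) ⟩
    (y + n) % n                    ≡⟨ [m+n]%n≡m%n y n ⟩
    y % n                          ∎
    where open ≡-Reasoning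

enumerate : ∀ {n} (S : Subset n) →
            Σ[ e ∈ (Fin ∣ S ∣ → Fin n) ] (Injective _≡_ _≡_ e × (∀ i → e i ∈ S))
enumerate []          = (λ ()) , (λ {}) , (λ ())
enumerate (false ∷ S) with e , e-inj , e∈S ← enumerate S =
  fs ∘ e , e-inj ∘ fs-injective , there ∘ e∈S
enumerate (true ∷ S)  with e , e-inj , e∈S ← enumerate S = e′ , e′-inj , e′∈S
  where
  e′ : Fin (suc ∣ S ∣) → Fin _
  e′ fz     = fz
  e′ (fs i) = fs (e i)
  e′-inj : Injective _≡_ _≡_ e′
  e′-inj {fz}   {fz}   _  = refl
  e′-inj {fs i} {fs j} eq = cong fs (e-inj (fs-injective eq))
  e′∈S : ∀ i → e′ i ∈ (true ∷ S)
  e′∈S fz     = here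
  e′∈S (fs i) = there (e∈S i)

rank : ∀ {n} (S : Subset n) (x : Fin n) → x ∈ S → Fin ∣ S ∣
rank (true ∷ S)  fz     here      = fz
rank (true ∷ S)  (fs x) (there p) = fs (rank S x p)
rank (false ∷ S) (fs x) (there p) = rank S x p

rank-injective : ∀ {n} (S : Subset n) x y (x∈S : x ∈ S) (y∈S : y ∈ S) →
                 rank S x x∈S ≡ rank S y y∈S → x ≡ y
rank-injective (true ∷ S)  fz     fz     here      here      eq = refl
rank-injective (true ∷ S)  (fs x) (fs y) (there p) (there q) eq = cong fs (rank-injective S x y p q (fs-injective eq))
rank-injective (false ∷ S) (fs x) (fs y) (there p) (there q) eq = cong fs (rank-injective S x y p q eq)

injection⇒≤∣S∣ : ∀ {n k} (S : Subset n) (e : Fin k → Fin n) →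
                 Injective _≡_ _≡_ e → (∀ i → e i ∈ S) → k ≤ ∣ S ∣
injection⇒≤∣S∣ S e e-inj e∈S =
  injective⇒≤ (λ {i} {j} eq → e-inj (rank-injective S (e i) (e j) (e∈S i) (e∈S j) eq))

uncurry-injective : ∀ {k m} {A : Set} (G : Fin k × Fin m → A) →
                    Injective _≡_ _≡_ G → Injective _≡_ _≡_ (G ∘ remQuot m)
uncurry-injective {k} {m} G G-inj {i} {j} eq = begin
  i                                  ≡⟨ combine-remQuot {k} m i ⟨
  uncurry combine (remQuot {k} m i) ≡⟨ cong (uncurry combine) (G-inj eq) ⟩
  uncurry combine (remQuot {k} m j) ≡⟨ combine-remQuot {k} m j ⟩
  j                                  ∎
  where open ≡-Reasoning

module UpperBound {n : ℕ} .{{_ : NonZero n}} {S : Subset n} (free : TFree n 3 S) where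
  open Congruence {n}
  open Forbidden free

  module Translates (a₀ : Fin n) (a∈S : a₀ ∈ S) where
    a = toℕ a₀

    translate : Fin 4 → ℕ → ℕ
    translate fz                t = t
    translate (fs fz)           t = n ∸ t
    translate (fs (fs fz))      t = a + t
    translate (fs (fs (fs fz))) t = a + (n ∸ t)

    ≤n : (b : Fin n) → toℕ b ≤ n
    ≤n b = <⇒≤ (toℕ<n b)

    neg-injective : ∀ {b c : Fin n} → n ∸ toℕ b ≈ n ∸ toℕ c → b ≡ c
    neg-injective {b} {c} eq = ≈⇒≡ (move-right {toℕ b} {0} (≤n b)
      (sym (subst (_≈ 0) (+-comm (n ∸ toℕ b) (toℕ c)) (move-right {toℕ c} (≤n c) eq))))

    S∩-S : ∀ {b c : Fin n} → b ∈ S → c ∈ S → toℕ b ≈ n ∸ toℕ c → ⊥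
    S∩-S {b} {c} b∈S c∈S eq = no-x+y≈0 b∈S c∈S (move-right {toℕ c} {toℕ b} {0} (≤n c) eq)

    S∩a+S : ∀ {b c : Fin n} → b ∈ S → c ∈ S → toℕ b ≈ a + toℕ c → ⊥
    S∩a+S b∈S c∈S eq = no-x+y≈z a∈S c∈S b∈S (sym eq)

    S∩a-S : ∀ {b c : Fin n} → b ∈ S → c ∈ S → toℕ b ≈ a + (n ∸ toℕ c) → ⊥
    S∩a-S {b} {c} b∈S c∈S eq = no-x+y≈z b∈S c∈S a∈S (move-right {toℕ c} (≤n c) eq)

    -- -b = a + c  gives  a + c + b = 0
    -S∩a+S : ∀ {b c : Fin n} → b ∈ S → c ∈ S → n ∸ toℕ b ≈ a + toℕ c → ⊥
    -S∩a+S {b} {c} b∈S c∈S eq = no-x+y+z≈0 a∈S c∈S b∈S (move-right {toℕ b} {a + toℕ c} {0} (≤n b) (sym eq))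

    -- -b = a - c  gives  a + b = c
    -S∩a-S : ∀ {b c : Fin n} → b ∈ S → c ∈ S → n ∸ toℕ b ≈ a + (n ∸ toℕ c) → ⊥
    -S∩a-S {b} {c} b∈S c∈S eq = no-x+y≈z a∈S b∈S c∈S (sym (move-right {toℕ c} {0} {a + toℕ b} (≤n c)
      (sym (subst (_≈ 0) (swap a (n ∸ toℕ c) (toℕ b)) (move-right {toℕ b} {a + (n ∸ toℕ c)} {0} (≤n b) (sym eq))))))
      where
      swap : ∀ x y z → x + y + z ≡ x + z + y
      swap = solve-∀

    a+S∩a-S : ∀ {b c : Fin n} → b ∈ S → c ∈ S → a + toℕ b ≈ a + (n ∸ toℕ c) → ⊥
    a+S∩a-S b∈S c∈S eq = S∩-S b∈S c∈S (+-cancelˡ a eq)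

    translates-disjoint : ∀ j j′ {b c : Fin n} → b ∈ S → c ∈ S →
                          translate j (toℕ b) ≈ translate j′ (toℕ c) → (j ≡ j′) × (b ≡ c)
    translates-disjoint fz                fz                b∈S c∈S eq = refl , ≈⇒≡ eq
    translates-disjoint fz                (fs fz)           b∈S c∈S eq = ⊥-elim (S∩-S b∈S c∈S eq)
    translates-disjoint fz                (fs (fs fz))      b∈S c∈S eq = ⊥-elim (S∩a+S b∈S c∈S eq)
    translates-disjoint fz                (fs (fs (fs fz))) b∈S c∈S eq = ⊥-elim (S∩a-S b∈S c∈S eq)
    translates-disjoint (fs fz)           fz                b∈S c∈S eq = ⊥-elim (S∩-S c∈S b∈S (sym eq))
    translates-disjoint (fs fz)           (fs fz)           b∈S c∈S eq = refl , neg-injective eq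
    translates-disjoint (fs fz)           (fs (fs fz))      b∈S c∈S eq = ⊥-elim (-S∩a+S b∈S c∈S eq)
    translates-disjoint (fs fz)           (fs (fs (fs fz))) b∈S c∈S eq = ⊥-elim (-S∩a-S b∈S c∈S eq)
    translates-disjoint (fs (fs fz))      fz                b∈S c∈S eq = ⊥-elim (S∩a+S c∈S b∈S (sym eq))
    translates-disjoint (fs (fs fz))      (fs fz)           b∈S c∈S eq = ⊥-elim (-S∩a+S c∈S b∈S (sym eq))
    translates-disjoint (fs (fs fz))      (fs (fs fz))      b∈S c∈S eq = refl , ≈⇒≡ (+-cancelˡ a eq)
    translates-disjoint (fs (fs fz))      (fs (fs (fs fz))) b∈S c∈S eq = ⊥-elim (a+S∩a-S b∈S c∈S eq)
    translates-disjoint (fs (fs (fs fz))) fz                b∈S c∈S eq = ⊥-elim (S∩a-S c∈S b∈S (sym eq))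
    translates-disjoint (fs (fs (fs fz))) (fs fz)           b∈S c∈S eq = ⊥-elim (-S∩a-S c∈S b∈S (sym eq))
    translates-disjoint (fs (fs (fs fz))) (fs (fs fz))      b∈S c∈S eq = ⊥-elim (a+S∩a-S c∈S b∈S (sym eq))
    translates-disjoint (fs (fs (fs fz))) (fs (fs (fs fz))) b∈S c∈S eq = refl , neg-injective (+-cancelˡ a eq)

  four-translates : 4 * ∣ S ∣ ≤ n
  four-translates with ∣ S ∣ | enumerate S
  ... | zero  | _                 = z≤n
  ... | suc m | e , e-inj , e∈S   = injective⇒≤ (uncurry-injective G G-inj)
    where
    open Translates (e fz) (e∈S fz)
    G : Fin 4 × Fin (suc m) → Fin n
    G (j , k) = reduce (translate j (toℕ (e k)))
    G-inj : Injective _≡_ _≡_ G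
    G-inj {j , k} {j′ , k′} eq with translates-disjoint j j′ (e∈S k) (e∈S k′) (reduce-injective eq)
    ... | refl , ek≡ek′ = cong (j ,_) (e-inj ek≡ek′)

  ∣S∣≤n/4 : ∣ S ∣ ≤ n / 4
  ∣S∣≤n/4 = subst (_≤ n / 4) (m*n/n≡m ∣ S ∣ 4) (/-monoˡ-≤ 4 (subst (_≤ n) (*-comm 4 ∣ S ∣) four-translates))

subsetOf : ∀ {n} {P : Fin n → Set} → Decidable P → Subset n
subsetOf P? = tabulate (λ i → does (P? i))

∈subsetOf⇒ : ∀ {n} {P : Fin n → Set} (P? : Decidable P) {x} → x ∈ subsetOf P? → P x
∈subsetOf⇒ P? {x} x∈ with P? x | trans (sym (lookup∘tabulate (λ i → does (P? i)) x)) ([]=⇒lookup x∈)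
... | yes p | _ = p
... | no _  | ()

⇒∈subsetOf : ∀ {n} {P : Fin n → Set} (P? : Decidable P) {x} → P x → x ∈ subsetOf P?
⇒∈subsetOf {P = P} P? {x} p = lookup⇒[]= x (subsetOf P?) (trans (lookup∘tabulate (λ i → does (P? i)) x) (holds (P? x)))
  where
  holds : (d : Dec (P x)) → does d ≡ true
  holds (yes _) = refl
  holds (no ¬p) = ⊥-elim (¬p p)

module Weighted {n : ℕ} {S : Subset n} {c : Fin n → ℕ} (c-over : MultisetOver S c) (w : Fin n → ℕ) where

  weight-lower : ∀ lo → (∀ i → i ∈ S → lo ≤ w i) → size c * lo ≤ Σ n (λ i → c i * w i)
  weight-lower lo lo≤w = subst (_≤ Σ n (λ i → c i * w i)) (Σ-*ʳ n c lo) (Σ-mono n termwise)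
    where
    termwise : ∀ i → c i * lo ≤ c i * w i
    termwise i with i ∈? S
    ... | yes i∈S = *-monoʳ-≤ (c i) (lo≤w i i∈S)
    ... | no  i∉S rewrite c-over i i∉S = z≤n

  weight-upper : ∀ hi → (∀ i → i ∈ S → w i ≤ hi) → Σ n (λ i → c i * w i) ≤ size c * hi
  weight-upper hi w≤hi = subst (Σ n (λ i → c i * w i) ≤_) (Σ-*ʳ n c hi) (Σ-mono n termwise)
    where
    termwise : ∀ i → c i * w i ≤ c i * hi
    termwise i with i ∈? S
    ... | yes i∈S = *-monoʳ-≤ (c i) (w≤hi i i∈S)
    ... | no  i∉S rewrite c-over i i∉S = z≤n

-- Σ c (1 + 2 w) = size c + 2 Σ c w, used to turn a bound on 2w + 1 into one on w.
Σ-odd-weight : ∀ n (c w : Fin n → ℕ) → Σ n (λ i → c i * suc (2 * w i)) ≡ Σ n c + 2 * Σ n (λ i → c i * w i)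
Σ-odd-weight n c w = trans (Σ-cong n (λ i → expand (c i) (w i)))
                           (trans (Σ-+ n c _) (cong (Σ n c +_) (Σ-*ˡ n (λ i → c i * w i) 2)))
  where
  expand : ∀ a x → a * suc (2 * x) ≡ a + 2 * (a * x)
  expand = solve-∀

0<m<q⇒m≉0 : ∀ {m q} .{{_ : NonZero q}} → 0 < m → m < q → m % q ≡ 0 % q → ⊥
0<m<q⇒m≉0 {m} {q} 0<m m<q eq with trans (sym (m<n⇒m%n≡m m<q)) (trans eq (m<n⇒m%n≡m (>-nonZero⁻¹ q)))
0<m<q⇒m≉0 {suc m} _ _ _ | ()

module EvenConstruction (n : ℕ) .{{_ : NonZero n}} (n-even : n % 2 ≡ 0) where
  open Multisets {n}

  SmallOdd : ℕ → Set
  SmallOdd x = (x % 2 ≡ 1) × (2 * x < n)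

  IsSmallOdd : Fin n → Set
  IsSmallOdd i = SmallOdd (toℕ i)

  isSmallOdd? : Decidable IsSmallOdd
  isSmallOdd? i = (toℕ i % 2 ≟ℕ 1) ×-dec (2 * toℕ i <? n)

  S₁ : Subset n
  S₁ = subsetOf isSmallOdd?

  small-odd : ∀ {i} → i ∈ S₁ → IsSmallOdd i
  small-odd = ∈subsetOf⇒ isSmallOdd?

  parity : ∀ c → MultisetOver S₁ c → msum c % 2 ≡ size c % 2
  parity c c-over = Σ-mod n 2 termwise
    where
    termwise : ∀ i → (c i * toℕ i) % 2 ≡ c i % 2
    termwise i with i ∈? S₁
    ... | yes i∈S = begin
        (c i * toℕ i) % 2                 ≡⟨ %-distribˡ-* (c i) (toℕ i) 2 ⟩
        ((c i % 2) * (toℕ i % 2)) % 2     ≡⟨ cong (λ t → ((c i % 2) * t) % 2) (proj₁ (small-odd i∈S)) ⟩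
        ((c i % 2) * 1) % 2               ≡⟨ cong (_% 2) (*-identityʳ (c i % 2)) ⟩
        c i % 2 % 2                       ≡⟨ m%n%n≡m%n (c i) 2 ⟩
        c i % 2                           ∎
      where open ≡-Reasoning
    ... | no i∉S rewrite c-over i i∉S = refl

  -- A sum of two elements of S₁ lies strictly between 0 and n.
  pair-sum≉0 : ∀ c → MultisetOver S₁ c → size c ≡ 2 → msum c % n ≡ 0 % n → ⊥
  pair-sum≉0 c c-over sc eq = 0<m<q⇒m≉0 0<msum msum<n eq
    where
    open Weighted c-over
    0<msum : 0 < msum c
    0<msum = ≤-trans (s≤s z≤n) (subst (_≤ msum c) (cong (_* 1) sc)
               (weight-lower toℕ 1 (λ i i∈S → odd⇒pos (toℕ i) (proj₁ (small-odd i∈S)))))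
      where
      odd⇒pos : ∀ x → x % 2 ≡ 1 → 1 ≤ x
      odd⇒pos (suc x) _ = s≤s z≤n
    2+2msum≤2n : 2 * suc (msum c) ≤ 2 * n
    2+2msum≤2n = subst₂ _≤_ (trans (cong (_+ 2 * msum c) sc) (double-suc (msum c))) (cong (_* n) sc)
                   (subst (_≤ size c * n) (Σ-odd-weight n c toℕ)
                     (weight-upper (λ i → suc (2 * toℕ i)) n (λ i i∈S → proj₂ (small-odd i∈S))))
      where
      double-suc : ∀ m → 2 + 2 * m ≡ 2 * suc m
      double-suc = solve-∀
    msum<n : msum c < n
    msum<n = *-cancelˡ-≤ 2 2+2msum≤2n

  -- Equal parity leaves only the cases 0 + 0, 1 + 1 (trivial) and 2 + 0 (excluded).
  S₁-free : TFree n 3 S₁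
  S₁-free c d c-over d-over le eq = by-sizes (size c) (size d) refl refl le same-parity
    where
    2∣n : 2 ∣ n
    2∣n = m%n≡0⇒n∣m n 2 n-even
    same-parity : size c % 2 ≡ size d % 2
    same-parity = begin
      size c % 2          ≡⟨ parity c c-over ⟨
      msum c % 2          ≡⟨ m∣n⇒o%n%m≡o%m 2 n (msum c) 2∣n ⟨
      msum c % n % 2      ≡⟨ cong (_% 2) eq ⟩
      msum d % n % 2      ≡⟨ m∣n⇒o%n%m≡o%m 2 n (msum d) 2∣n ⟩
      msum d % 2          ≡⟨ parity d d-over ⟩
      size d % 2          ∎
      where open ≡-Reasoning
    by-sizes : ∀ k l → size c ≡ k → size d ≡ l → k + l ≤ 3 → k % 2 ≡ l % 2 → ∀ i → c i ≡ d i
    by-sizes 0 0 sc sd _ _ = same-empty sc sd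
    by-sizes 1 1 sc sd _ _ = same-single sc sd eq
    by-sizes 2 0 sc sd _ _ = ⊥-elim (pair-sum≉0 c c-over sc (trans eq (cong (_% n) (msum-empty sd))))
    by-sizes 0 2 sc sd _ _ = ⊥-elim (pair-sum≉0 d d-over sd (trans (sym eq) (cong (_% n) (msum-empty sc))))
    by-sizes 0 1 _ _ _ ()
    by-sizes 1 0 _ _ _ ()
    by-sizes 0 3 _ _ _ ()
    by-sizes 3 0 _ _ _ ()
    by-sizes 1 2 _ _ _ ()
    by-sizes 2 1 _ _ _ ()
    by-sizes 0 (suc (suc (suc (suc _)))) _ _ (s≤s (s≤s (s≤s ()))) _
    by-sizes 1 (suc (suc (suc _)))       _ _ (s≤s (s≤s (s≤s ()))) _
    by-sizes 2 (suc (suc _))             _ _ (s≤s (s≤s (s≤s ()))) _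
    by-sizes 3 (suc _)                   _ _ (s≤s (s≤s (s≤s ()))) _
    by-sizes (suc (suc (suc (suc _)))) _ _ _ (s≤s (s≤s (s≤s ()))) _

  module _ (i : Fin (n / 4)) where
    4[i+1]≤n : suc (toℕ i) * 4 ≤ n
    4[i+1]≤n = ≤-trans (*-monoˡ-≤ 4 (toℕ<n i)) (m/n*n≤m n 4)

    2[2i+1]<n : 2 * suc (2 * toℕ i) < n
    2[2i+1]<n = ≤-trans (subst (suc (2 * suc (2 * toℕ i)) ≤_) (expand (toℕ i)) (m≤m+n _ 1)) 4[i+1]≤n
      where
      expand : ∀ x → suc (2 * suc (2 * x)) + 1 ≡ suc x * 4
      expand = solve-∀

    2i+1<n : suc (2 * toℕ i) < n
    2i+1<n = ≤-trans (subst (suc (suc (2 * toℕ i)) ≤_) (expand (toℕ i)) (m≤m+n _ _)) 4[i+1]≤n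
      where
      expand : ∀ x → suc (suc (2 * x)) + (2 + 2 * x) ≡ suc x * 4
      expand = solve-∀

  odd-embedding : Fin (n / 4) → Fin n
  odd-embedding i = fromℕ< (2i+1<n i)

  odd-embedding-injective : Injective _≡_ _≡_ odd-embedding
  odd-embedding-injective {i} {j} eq = toℕ-injective (*-cancelˡ-≡ (toℕ i) (toℕ j) 2
    (suc-injective (trans (sym (toℕ-fromℕ< (2i+1<n i))) (trans (cong toℕ eq) (toℕ-fromℕ< (2i+1<n j))))))

  odd-embedding∈S₁ : ∀ i → odd-embedding i ∈ S₁
  odd-embedding∈S₁ i = ⇒∈subsetOf isSmallOdd? (subst SmallOdd (sym (toℕ-fromℕ< (2i+1<n i))) (odd , 2[2i+1]<n i))
    where
    odd : suc (2 * toℕ i) % 2 ≡ 1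
    odd = trans (cong (λ t → suc t % 2) (*-comm 2 (toℕ i))) ([m+kn]%n≡m%n 1 (toℕ i) 2)

  s≡n/4 : SIs n 3 (n / 4)
  s≡n/4 = (S₁ , S₁-free , ≤-antisym (UpperBound.∣S∣≤n/4 S₁-free)
                            (injection⇒≤∣S∣ S₁ odd-embedding odd-embedding-injective odd-embedding∈S₁)) ,
          (λ S free → UpperBound.∣S∣≤n/4 free)

-- Arithmetic of window sums.  A sum R of k residues from the window
-- q < 3r, 2r < q satisfies k (q + 1) ≤ 3R and k + 2R ≤ k q.

one-term-range : ∀ {q} R → 1 * suc q ≤ 3 * R → 1 + 2 * R ≤ 1 * q → (0 < R) × (R < q)
one-term-range {q} (suc R) _ upper =
  s≤s z≤n , ≤-trans (s≤s (m≤m+n (suc R) _)) (subst (suc (2 * suc R) ≤_) (*-identityˡ q) upper)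

two-term-range : ∀ {q} R → 2 * suc q ≤ 3 * R → 2 + 2 * R ≤ 2 * q → (0 < R) × (R < q)
two-term-range {q} (suc R) _ upper = s≤s z≤n , *-cancelˡ-≤ 2 (subst (_≤ 2 * q) (expand R) upper)
  where
  expand : ∀ R → 2 + 2 * suc R ≡ 2 * suc (suc R)
  expand = solve-∀

three-term-range : ∀ {q} R → 3 * suc q ≤ 3 * R → 3 + 2 * R ≤ 3 * q →
                   ∃ λ R′ → (R ≡ R′ + q) × (0 < R′) × (R′ < q)
three-term-range {q} R lower upper with d , q+1+d≡R ← m≤n⇒∃[o]m+o≡n (*-cancelˡ-≤ 3 lower) =
  suc d , trans (sym q+1+d≡R) (trans (+-comm (suc q) d) (+-suc d q)) , s≤s z≤n , d+1<q
  where
  d+1<q : suc d < q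
  d+1<q = ≤-trans (s≤s (s≤s (m≤n+m d _)))
    (+-cancelˡ-≤ (2 * q) _ _ (subst₂ _≤_ (trans (cong (λ x → 3 + 2 * x) (sym q+1+d≡R)) (expand q d)) (split q) upper))
    where
    expand : ∀ q d → 3 + 2 * (suc q + d) ≡ 2 * q + (5 + d + d)
    expand = solve-∀
    split : ∀ q → 3 * q ≡ 2 * q + q
    split = solve-∀

-- A one-term sum and a two-term sum cannot coincide.
one≢two : ∀ q R → 2 * suc q ≤ 3 * R → 1 + 2 * R ≤ q → ⊥
one≢two q R two-lower one-upper = m+1+n≰m (3 * q) (subst (_≤ 3 * q) (expand q) chain)
  where
  chain : 2 * (2 * suc q) + 3 ≤ 3 * q
  chain = ≤-trans (+-monoˡ-≤ 3 (*-monoʳ-≤ 2 two-lower))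
                  (subst (_≤ 3 * q) (sym (regroup R)) (*-monoʳ-≤ 3 one-upper))
    where
    regroup : ∀ x → 2 * (3 * x) + 3 ≡ 3 * (1 + 2 * x)
    regroup = solve-∀
  expand : ∀ q → 2 * (2 * suc q) + 3 ≡ 3 * q + suc (q + 6)
  expand = solve-∀

module WindowConstruction (n : ℕ) .{{_ : NonZero n}} (q : ℕ) .{{_ : NonZero q}} (q∣n : q ∣ n) where
  open Multisets {n}

  InWindow : ℕ → Set
  InWindow r = (q < 3 * r) × (2 * r < q)

  residue : Fin n → ℕ
  residue i = toℕ i % q

  inWindow? : Decidable (InWindow ∘ residue)
  inWindow? i = (q <? 3 * residue i) ×-dec (2 * residue i <? q)

  S₂ : Subset n
  S₂ = subsetOf inWindow?

  residue-sum : (Fin n → ℕ) → ℕ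
  residue-sum c = Σ n (λ i → c i * residue i)

  msum≈residue-sum : ∀ c → msum c % q ≡ residue-sum c % q
  msum≈residue-sum c = Σ-mod n q termwise
    where
    termwise : ∀ i → (c i * toℕ i) % q ≡ (c i * residue i) % q
    termwise i = begin
      (c i * toℕ i) % q                 ≡⟨ %-distribˡ-* (c i) (toℕ i) q ⟩
      (c i % q * (toℕ i % q)) % q       ≡⟨ cong (λ t → (c i % q * t) % q) (m%n%n≡m%n (toℕ i) q) ⟨
      (c i % q * (residue i % q)) % q   ≡⟨ %-distribˡ-* (c i) (residue i) q ⟨
      (c i * residue i) % q             ∎
      where open ≡-Reasoning

  residue-sum-empty : ∀ {c} → size c ≡ 0 → residue-sum c ≡ 0
  residue-sum-empty {c} sc = trans (Σ-cong n (λ i → cong (_* residue i) (Σ≡0 n sc i))) (Σ-zero n)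

  window-bounds : ∀ c → MultisetOver S₂ c →
                  (size c * suc q ≤ 3 * residue-sum c) × (size c + 2 * residue-sum c ≤ size c * q)
  window-bounds c c-over =
    subst (size c * suc q ≤_) (trans (Σ-cong n (λ i → triple (c i) (residue i))) (Σ-*ˡ n (λ i → c i * residue i) 3))
      (weight-lower (λ i → 3 * residue i) (suc q) (λ i i∈S → proj₁ (∈subsetOf⇒ inWindow? i∈S))) ,
    subst (_≤ size c * q) (Σ-odd-weight n c residue)
      (weight-upper (λ i → suc (2 * residue i)) q (λ i i∈S → proj₂ (∈subsetOf⇒ inWindow? i∈S)))
    where
    open Weighted c-over
    triple : ∀ a x → a * (3 * x) ≡ 3 * (a * x)
    triple = solve-∀

  window-bounds-for : ∀ c k → MultisetOver S₂ c → size c ≡ k →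
                      (k * suc q ≤ 3 * residue-sum c) × (k + 2 * residue-sum c ≤ k * q)
  window-bounds-for c k c-over refl = window-bounds c c-over

  window-sum≉0 : ∀ c k → MultisetOver S₂ c → size c ≡ k → 1 ≤ k → k ≤ 3 →
                 residue-sum c % q ≡ 0 % q → ⊥
  window-sum≉0 c k c-over sc 1≤k k≤3 eq =
    uncurry (by-size k 1≤k k≤3) (window-bounds-for c k c-over sc)
    where
    R = residue-sum c
    by-size : ∀ k → 1 ≤ k → k ≤ 3 → k * suc q ≤ 3 * R → k + 2 * R ≤ k * q → ⊥
    by-size 1 _ _ lower upper with 0<R , R<q ← one-term-range R lower upper = 0<m<q⇒m≉0 0<R R<q eq
    by-size 2 _ _ lower upper with 0<R , R<q ← two-term-range R lower upper = 0<m<q⇒m≉0 0<R R<q eq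
    by-size 3 _ _ lower upper with R′ , R≡R′+q , 0<R′ , R′<q ← three-term-range R lower upper =
      0<m<q⇒m≉0 0<R′ R′<q (trans (sym ([m+n]%n≡m%n R′ q)) (trans (cong (_% q) (sym R≡R′+q)) eq))
    by-size (suc (suc (suc (suc _)))) _ (s≤s (s≤s (s≤s ()))) _ _

  -- A one-term window sum never matches a two-term window sum mod q:
  -- both residue sums lie in (0, q), so they would be equal.
  one-term≉two-term : ∀ c d → MultisetOver S₂ c → MultisetOver S₂ d → size c ≡ 1 → size d ≡ 2 →
                      residue-sum c % q ≡ residue-sum d % q → ⊥
  one-term≉two-term c d c-over d-over sc sd eq
    with c-lower , c-upper ← window-bounds-for c 1 c-over sc
       | d-lower , d-upper ← window-bounds-for d 2 d-over sd
    with _ , Rc<q ← one-term-range (residue-sum c) c-lower c-upper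
       | _ , Rd<q ← two-term-range (residue-sum d) d-lower d-upper
    = one≢two q (residue-sum c) (subst (λ x → 2 * suc q ≤ 3 * x) (sym Rc≡Rd) d-lower)
                                (subst (1 + 2 * residue-sum c ≤_) (*-identityˡ q) c-upper)
    where
    Rc≡Rd : residue-sum c ≡ residue-sum d
    Rc≡Rd = trans (sym (m<n⇒m%n≡m Rc<q)) (trans eq (m<n⇒m%n≡m Rd<q))

  S₂-free : TFree n 3 S₂
  S₂-free c d c-over d-over le eq = by-sizes (size c) (size d) refl refl le
    where
    eq-mod-q : residue-sum c % q ≡ residue-sum d % q
    eq-mod-q = begin
      residue-sum c % q     ≡⟨ msum≈residue-sum c ⟨
      msum c % q            ≡⟨ m∣n⇒o%n%m≡o%m q n (msum c) q∣n ⟨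
      msum c % n % q        ≡⟨ cong (_% q) eq ⟩
      msum d % n % q        ≡⟨ m∣n⇒o%n%m≡o%m q n (msum d) q∣n ⟩
      msum d % q            ≡⟨ msum≈residue-sum d ⟩
      residue-sum d % q     ∎
      where open ≡-Reasoning
    by-sizes : ∀ k l → size c ≡ k → size d ≡ l → k + l ≤ 3 → ∀ i → c i ≡ d i
    by-sizes 0       0       sc sd _  = same-empty sc sd
    by-sizes 1       1       sc sd _  = same-single sc sd eq
    by-sizes 0       (suc l) sc sd le = ⊥-elim (window-sum≉0 d (suc l) d-over sd (s≤s z≤n) le
      (trans (sym eq-mod-q) (cong (_% q) (residue-sum-empty sc))))
    by-sizes (suc k) 0       sc sd le = ⊥-elim (window-sum≉0 c (suc k) c-over sc (s≤s z≤n)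
      (subst (_≤ 3) (+-identityʳ (suc k)) le) (trans eq-mod-q (cong (_% q) (residue-sum-empty sd))))
    by-sizes 1       2       sc sd _  = ⊥-elim (one-term≉two-term c d c-over d-over sc sd eq-mod-q)
    by-sizes 2       1       sc sd _  = ⊥-elim (one-term≉two-term d c d-over c-over sd sc (sym eq-mod-q))
    by-sizes 1 (suc (suc (suc _)))     _ _ (s≤s (s≤s (s≤s ())))
    by-sizes 2 (suc (suc _))           _ _ (s≤s (s≤s (s≤s ())))
    by-sizes (suc (suc (suc k))) (suc l) _ _ (s≤s (s≤s (s≤s k+l+1≤0)))
      with () ← subst (_≤ 0) (+-suc k l) k+l+1≤0

  window-interval : ∀ L c → q < 3 * L → 2 * (L + c) ≤ suc q → ∀ t → t < c → InWindow (L + t)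
  window-interval L c q<3L 2[L+c]≤q+1 t t<c =
    <-≤-trans q<3L (*-monoʳ-≤ 3 (m≤m+n L t)) ,
    ≤-pred (subst (_≤ suc q) (expand L t) (≤-trans (*-monoʳ-≤ 2 (+-monoʳ-≤ L t<c)) 2[L+c]≤q+1))
    where
    expand : ∀ L t → 2 * (L + suc t) ≡ suc (suc (2 * (L + t)))
    expand = solve-∀

  -- A run of c window residues L, …, L + c - 1 lifts to c · (n / q) elements
  -- of S₂, namely (L + t) + j q for t < c and j < n / q.
  run-count : ∀ L c → q < 3 * L → 2 * (L + c) ≤ suc q → c * (n / q) ≤ ∣ S₂ ∣
  run-count L c q<3L 2[L+c]≤q+1 =
    injection⇒≤∣S∣ S₂ (lift ∘ remQuot m) (uncurry-injective lift lift-injective) (lift∈S₂ ∘ remQuot m)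
    where
    m = n / q
    run : ∀ t → t < c → InWindow (L + t)
    run = window-interval L c q<3L 2[L+c]≤q+1

    L+t<q : ∀ (t : Fin c) → L + toℕ t < q
    L+t<q t = ≤-trans (s≤s (m≤m+n _ _)) (proj₂ (run (toℕ t) (toℕ<n t)))

    value : Fin c → Fin m → ℕ
    value t j = (L + toℕ t) + toℕ j * q

    value<n : ∀ t j → value t j < n
    value<n t j = subst (value t j <_) (m/n*n≡m q∣n)
                    (≤-trans (+-monoˡ-< (toℕ j * q) (L+t<q t)) (*-monoˡ-≤ q (toℕ<n j)))

    value%q : ∀ t j → value t j % q ≡ L + toℕ t
    value%q t j = trans ([m+kn]%n≡m%n (L + toℕ t) (toℕ j) q) (m<n⇒m%n≡m (L+t<q t))

    lift : Fin c × Fin m → Fin n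
    lift (t , j) = fromℕ< (value<n t j)

    toℕ-lift : ∀ t j → toℕ (lift (t , j)) ≡ value t j
    toℕ-lift t j = toℕ-fromℕ< (value<n t j)

    lift-injective : Injective _≡_ _≡_ lift
    lift-injective {t , j} {t′ , j′} eq = cong₂ _,_ t≡t′ j≡j′
      where
      values≡ : value t j ≡ value t′ j′
      values≡ = trans (sym (toℕ-lift t j)) (trans (cong toℕ eq) (toℕ-lift t′ j′))
      t≡t′ : t ≡ t′
      t≡t′ = toℕ-injective (+-cancelˡ-≡ L _ _ (trans (sym (value%q t j)) (trans (cong (_% q) values≡) (value%q t′ j′))))
      j≡j′ : j ≡ j′
      j≡j′ = toℕ-injective (*-cancelʳ-≡ (toℕ j) (toℕ j′) q
               (+-cancelˡ-≡ (L + toℕ t) _ _ (trans values≡ (cong (λ s → L + toℕ s + toℕ j′ * q) (sym t≡t′)))))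

    lift∈S₂ : ∀ x → lift x ∈ S₂
    lift∈S₂ (t , j) = ⇒∈subsetOf inWindow?
      (subst InWindow (sym (trans (cong (_% q) (toℕ-lift t j)) (value%q t j))) (run (toℕ t) (toℕ<n t)))

≤-by : ∀ {a b} d → a + d ≡ b → a ≤ b
≤-by {a} d eq = subst (a ≤_) eq (m≤m+n a d)

odd-window-run : ∀ r k → r < 6 → r % 2 ≡ 1 →
                 ∃ λ L → (r + k * 6 < 3 * L) × (2 * (L + k) ≤ suc (r + k * 6))
odd-window-run 1 k _ _ = 2 * k + 1 , ≤-by 1 (lower k) , ≤-by 0 (upper k)
  where
  lower : ∀ k → suc (1 + k * 6) + 1 ≡ 3 * (2 * k + 1)
  lower = solve-∀
  upper : ∀ k → 2 * (2 * k + 1 + k) + 0 ≡ suc (1 + k * 6)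
  upper = solve-∀
odd-window-run 3 k _ _ = 2 * k + 2 , ≤-by 2 (lower k) , ≤-by 0 (upper k)
  where
  lower : ∀ k → suc (3 + k * 6) + 2 ≡ 3 * (2 * k + 2)
  lower = solve-∀
  upper : ∀ k → 2 * (2 * k + 2 + k) + 0 ≡ suc (3 + k * 6)
  upper = solve-∀
odd-window-run 5 k _ _ = 2 * k + 2 , ≤-by 0 (lower k) , ≤-by 2 (upper k)
  where
  lower : ∀ k → suc (5 + k * 6) + 0 ≡ 3 * (2 * k + 2)
  lower = solve-∀
  upper : ∀ k → 2 * (2 * k + 2 + k) + 2 ≡ suc (5 + k * 6)
  upper = solve-∀
odd-window-run (suc (suc (suc (suc (suc (suc _)))))) k (s≤s (s≤s (s≤s (s≤s (s≤s (s≤s ())))))) _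

odd-lower-bound : ∀ n .{{_ : NonZero n}} → n % 2 ≡ 1 → SAtLeast n 3 (n / 6)
odd-lower-bound n n-odd = from-run (odd-window-run r k (m%n<n n 6) r-odd)
  where
  open WindowConstruction n n ∣-refl
  r = n % 6
  k = n / 6
  n≡r+6k : n ≡ r + k * 6
  n≡r+6k = m≡m%n+[m/n]*n n 6
  r-odd : r % 2 ≡ 1
  r-odd = begin
    r % 2                    ≡⟨ [m+kn]%n≡m%n r (k * 3) 2 ⟨
    (r + k * 3 * 2) % 2      ≡⟨ cong (λ x → (r + x) % 2) (*-assoc k 3 2) ⟩
    (r + k * 6) % 2          ≡⟨ cong (_% 2) n≡r+6k ⟨
    n % 2                    ≡⟨ n-odd ⟩
    1                        ∎
    where open ≡-Reasoning
  from-run : ∃ (λ L → (r + k * 6 < 3 * L) × (2 * (L + k) ≤ suc (r + k * 6))) → SAtLeast n 3 k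
  from-run (L , n<3L , 2[L+k]≤n+1) =
    S₂ , S₂-free ,
    subst (_≤ ∣ S₂ ∣) (trans (cong (k *_) (n/n≡1 n)) (*-identityʳ k))
      (run-count L k (subst (_< 3 * L) (sym n≡r+6k) n<3L)
                     (subst (λ x → 2 * (L + k) ≤ suc x) (sym n≡r+6k) 2[L+k]≤n+1))

-- Part (iii): for p ∣ n with p = 6K + 5, the window mod p contains the K + 1
-- residues 2K + 2, …, 3K + 2, giving (K + 1) · n / p = (p + 1) n / (6p) elements.
window-mod-p-lower-bound : ∀ n .{{_ : NonZero n}} p → p ∣ n → p % 6 ≡ 5 → SAtLeastFrac n 3 ((p + 1) * n) (6 * p)
window-mod-p-lower-bound n p@(suc _) p∣n p%6≡5 =
  S₂ , S₂-free , subst (_≤ 6 * p * ∣ S₂ ∣) (sym count≡) (*-monoʳ-≤ (6 * p) (run-count L (suc K) p<3L 2[L+K+1]≤p+1))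
  where
  open WindowConstruction n p p∣n
  K = p / 6
  L = 2 * K + 2
  p≡5+6K : p ≡ 5 + K * 6
  p≡5+6K = trans (m≡m%n+[m/n]*n p 6) (cong (_+ K * 6) p%6≡5)
  p<3L : p < 3 * L
  p<3L = subst (λ x → x < 3 * L) (sym p≡5+6K) (≤-by 0 (lower K))
    where
    lower : ∀ K → suc (5 + K * 6) + 0 ≡ 3 * (2 * K + 2)
    lower = solve-∀
  2[L+K+1]≤p+1 : 2 * (L + suc K) ≤ suc p
  2[L+K+1]≤p+1 = subst (λ x → 2 * (L + suc K) ≤ suc x) (sym p≡5+6K) (≤-by 0 (upper K))
    where
    upper : ∀ K → 2 * (2 * K + 2 + suc K) + 0 ≡ suc (5 + K * 6)
    upper = solve-∀
  count≡ : (p + 1) * n ≡ 6 * p * (suc K * (n / p))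
  count≡ = begin
    (p + 1) * n                            ≡⟨ cong₂ _*_ (cong (_+ 1) p≡5+6K) (sym (m/n*n≡m p∣n)) ⟩
    (5 + K * 6 + 1) * (n / p * p)          ≡⟨ regroup K (n / p) p ⟩
    6 * p * (suc K * (n / p))              ∎
    where
    open ≡-Reasoning
    regroup : ∀ K m p → (5 + K * 6 + 1) * (m * p) ≡ 6 * p * (suc K * m)
    regroup = solve-∀

proposition12 : (n : ℕ) .{{_ : NonZero n}} →
    (n % 2 ≡ 0 → SIs n 3 (n / 4)) ×
    (n % 2 ≡ 1 → (∀ q → Prime q → q ∣ n → ¬ (q % 6 ≡ 5)) → SAtLeast n 3 (n / 6)) ×
    (∀ p → n % 2 ≡ 1 → Prime p → p ∣ n → p % 6 ≡ 5 →
    (∀ q → Prime q → q ∣ n → q % 6 ≡ 5 → p ≤ q) →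
    SAtLeastFrac n 3 ((p + 1) * n) (6 * p))
proposition12 n =
  (λ n-even → EvenConstruction.s≡n/4 n n-even) ,
  (λ n-odd _ → odd-lower-bound n n-odd) ,
  (λ p _ _ p∣n p%6≡5 _ → window-mod-p-lower-bound n p p∣n p%6≡5)
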